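{- If $a$ is a positive integer, then \[\overline{p}(a\mid \text{no } 1\text{'s})\,\overline{p}(1) \ge \overline{p}(a+1\mid \text{no } 1\text{'s}),\] and if moreover $a\ge3$, the inequality is strict.
   Context: An overpartition of $n$ is a partition of $n$ in which the last occurrence of each distinct part may be overlined; $\overline{p}(n)$ is the number of overpartitions of $n$. $\overline{p}(n\mid \text{no } 1\text{'s})$ denotes the number of overpartitions of $n$ having no non-overlined part equal to $1$ (an overlined part $\overline{1}$ is allowed). -}

module Defs where

open import Data.Nat using (ℕ; zero; suc; _+_; _≤_; _<_)
open import Data.Bool using (Bool; true; false)
open import Data.Product using (_×_; _,_; proj₁)
open import Data.Sum using (_⊎_)
open import Data.List using (List; map)
open import Data.Nat.ListAction using (sum)
open import Data.List.Relation.Unary.All using (All)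
open import Data.List.Relation.Unary.Linked using (Linked)
open import Data.Fin using (Fin)
open import Function.Bundles using (_↔_)
open import Relation.Binary.PropositionalEquality using (_≡_)

-- A part of an overpartition: its size together with a flag saying
-- whether it is overlined (true = overlined).
Part : Set
Part = ℕ × Bool

-- Ordering between consecutive parts in the canonical listing of an
-- overpartition: parts are listed in non-increasing order of size, and
-- among equal sizes only the LAST occurrence may be overlined, i.e. an
-- entry followed by an entry of the same size must be non-overlined.
data Step : Part → Part → Set where
  strict : ∀ {u v b c} → v < u → Step (u , b) (v , c)
  equal  : ∀ {v c} → Step (v , false) (v , c)

record Overpartition (n : ℕ) : Set where
  constructor mkOP
  field
    parts    : List Part
    positive : All (λ p → 1 ≤ proj₁ p) parts
    ordered  : Linked Step parts
    sums     : sum (map proj₁ parts) ≡ n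

data NotPlainOne : Part → Set where
  overlined : ∀ {v} → NotPlainOne (v , true)
  big       : ∀ {v} → 2 ≤ v → NotPlainOne (v , false)

record OverpartitionNo1 (n : ℕ) : Set where
  constructor mkOPno1
  field
    op    : Overpartition n
    no1   : All NotPlainOne (Overpartition.parts op)

_HasSize_ : Set → ℕ → Set
A HasSize k = Fin k ↔ A

{-# OPTIONS --safe #-}
module Submission where

-- Let λ be an overpartition of a + 1 with no plain 1. Lowering its smallest
-- (last) part by one gives an overpartition of a with no plain 1, except
-- that a plain 2 cannot become a plain 1: it becomes 1̄ instead, and a part 1̄
-- is deleted. The overpartition of 1, i.e. a choice between 1 and 1̄, records
-- which case occurred, so that λ can be recovered. This gives an injection
-- into the pairs, and for a ≥ 3 some pair, such as (2̄ + 1̄, 1̄), is not in its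
-- image, since raising it would give 2̄ + 2.

open import Defs
open import Data.Nat using (ℕ; zero; suc; _+_; _*_; pred; _≤_; _<_; z≤n; s≤s)
open import Data.Nat.Properties using (≤-irrelevant; ≡-irrelevant; <-irrefl; ≤-refl; ≤-trans; n≤1+n; +-suc; +-comm; suc-injective)
open import Data.Nat.ListAction using (sum)
open import Data.Bool using (Bool; true; false; not)
open import Data.Product using (_×_; _,_; proj₁; proj₂; map₁; uncurry; Σ-syntax)
open import Data.Product.Function.NonDependent.Propositional using (_×-↔_)
open import Data.List using (List; []; _∷_; map; head)
open import Data.List.Relation.Unary.All as All using (All; []; _∷_)
open import Data.List.Relation.Unary.Linked as Linked using (Linked; []; [-]; _∷_; _∷′_)
open import Data.Maybe using (just)
open import Data.Maybe.Relation.Binary.Connected using (Connected; just; just-nothing)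
open import Data.Fin using (Fin)
open import Data.Fin.Properties using (injective⇒≤; *↔×)
open import Data.Empty using (⊥-elim)
open import Function.Base using (_∘_)
open import Function.Bundles using (Injection; _↣_; mk↣; Inverse)
open import Function.Definitions using (Injective)
open import Function.Properties.Inverse using (↔-sym; ↔-trans; ↔⇒↣)
open import Function.Properties.Injection using (↣-trans)
open import Relation.Binary.PropositionalEquality using (_≡_; _≢_; refl; sym; trans; cong; subst; module ≡-Reasoning)
open import Relation.Nullary using (¬_)
open import Relation.Unary using (_∩_)

module _ {m n : ℕ} where

  injective-missing⇒< : {f : Fin m → Fin n} → Injective _≡_ _≡_ f →
                        (k : Fin n) → (∀ i → f i ≢ k) → m < n
  injective-missing⇒< {f} f-injective k k∉f = injective⇒≤ extend-injective
    where
    extend : Fin (suc m) → Fin n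
    extend Fin.zero    = k
    extend (Fin.suc i) = f i

    extend-injective : Injective _≡_ _≡_ extend
    extend-injective {Fin.zero}  {Fin.zero}  _  = refl
    extend-injective {Fin.zero}  {Fin.suc j} eq = ⊥-elim (k∉f j (sym eq))
    extend-injective {Fin.suc i} {Fin.zero}  eq = ⊥-elim (k∉f i eq)
    extend-injective {Fin.suc i} {Fin.suc j} eq = cong Fin.suc (f-injective eq)

module _ {A B : Set} {m n : ℕ} (A-size : A HasSize m) (B-size : B HasSize n) (f : A ↣ B) where

  private
    through-Fin : Fin m ↣ Fin n
    through-Fin = ↣-trans (↔⇒↣ A-size) (↣-trans f (↔⇒↣ (↔-sym B-size)))

  HasSize-≤ : m ≤ n
  HasSize-≤ = injective⇒≤ (Injection.injective through-Fin)

  HasSize-< : (b : B) → (∀ x → Injection.to f x ≢ b) → m < n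
  HasSize-< b b∉f = injective-missing⇒< (Injection.injective through-Fin) (Inverse.from B-size b)
    λ i eq → b∉f (Inverse.to A-size i) (Injection.injective (↔⇒↣ (↔-sym B-size)) eq)

×-HasSize : {A B : Set} {m n : ℕ} → A HasSize m → B HasSize n → (A × B) HasSize (m * n)
×-HasSize A-size B-size = ↔-trans *↔× (A-size ×-↔ B-size)

Step-irrelevant : ∀ {p q} (s t : Step p q) → s ≡ t
Step-irrelevant (strict v<u) (strict v<u′) = cong strict (≤-irrelevant v<u v<u′)
Step-irrelevant (strict v<v) equal         = ⊥-elim (<-irrefl refl v<v)
Step-irrelevant equal        (strict v<v)  = ⊥-elim (<-irrefl refl v<v)
Step-irrelevant equal        equal         = refl

NotPlainOne-irrelevant : ∀ {p} (s t : NotPlainOne p) → s ≡ t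
NotPlainOne-irrelevant overlined overlined  = refl
NotPlainOne-irrelevant (big 2≤v) (big 2≤v′) = cong big (≤-irrelevant 2≤v 2≤v′)

parts : ∀ {n} → OverpartitionNo1 n → List Part
parts λ₁ = Overpartition.parts (OverpartitionNo1.op λ₁)

parts-injective : ∀ {n} (λ₁ λ₂ : OverpartitionNo1 n) → parts λ₁ ≡ parts λ₂ → λ₁ ≡ λ₂
parts-injective (mkOPno1 (mkOP ps pos ord sums) no1) (mkOPno1 (mkOP .ps pos′ ord′ sums′) no1′) refl
  with refl ← All.irrelevant ≤-irrelevant pos pos′
     | refl ← Linked.irrelevant Step-irrelevant ord ord′
     | refl ← ≡-irrelevant sums sums′
     | refl ← All.irrelevant NotPlainOne-irrelevant no1 no1′
  = refl

Positive : Part → Set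
Positive p = 1 ≤ proj₁ p

total : List Part → ℕ
total ps = sum (map proj₁ ps)

Step-≤ : ∀ {u b v c} → Step (u , b) (v , c) → v ≤ u
Step-≤ (strict v<u) = ≤-trans (n≤1+n _) v<u
Step-≤ equal        = ≤-refl

Step-pred : ∀ {w v b c} → Step w (suc v , b) → Step w (v , c)
Step-pred {w = _ , _} s = strict (Step-≤ s)

-- The returned flag is the overline of the overpartition of 1. The clauses for
-- a part 0 or a plain 1 are junk: such a part is never lowered.
lowerLast : Part → List Part × Bool
lowerLast (1 , true) = [] , true
lowerLast (2 , c)    = (1 , true) ∷ [] , not c
lowerLast (v , c)    = (pred v , c) ∷ [] , false

lower : Part → List Part → List Part × Bool
lower x []       = lowerLast x
lower x (y ∷ ys) = map₁ (x ∷_) (lower y ys)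

raiseLast : Part → Bool → List Part
raiseLast (v , c)    false = (suc v , c) ∷ []
raiseLast (1 , true) true  = (2 , false) ∷ []
raiseLast p          true  = p ∷ (1 , true) ∷ []

raise : List Part → Bool → List Part
raise []           false = []
raise []           true  = (1 , true) ∷ []
raise (x ∷ [])     b     = raiseLast x b
raise (x ∷ y ∷ xs) b     = x ∷ raise (y ∷ xs) b

raiseLast-above-1̄ : ∀ {x} → Step x (1 , true) → raiseLast x true ≡ x ∷ (1 , true) ∷ []
raiseLast-above-1̄ {zero , _}        (strict ())
raiseLast-above-1̄ {suc zero , true}  (strict (s≤s ()))
raiseLast-above-1̄ {suc zero , false} _ = refl
raiseLast-above-1̄ {suc (suc v) , _}  _ = refl

raise-lower : ∀ x xs → All Positive (x ∷ xs) → All NotPlainOne (x ∷ xs) → Linked Step (x ∷ xs) →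
              uncurry raise (lower x xs) ≡ x ∷ xs
raise-lower (zero , _)                [] (() ∷ _) _ _
raise-lower (suc zero , true)         [] _ _ _ = refl
raise-lower (suc zero , false)        [] _ (big (s≤s ()) ∷ _) _
raise-lower (suc (suc zero) , false)  [] _ _ _ = refl
raise-lower (suc (suc zero) , true)   [] _ _ _ = refl
raise-lower (suc (suc (suc v)) , _)   [] _ _ _ = refl
raise-lower x (y ∷ ys) (_ ∷ pos) (_ ∷ no1) (x≥y ∷ ord)
  with lower y ys | raise-lower y ys pos no1 ord
... | z ∷ zs , b | raised = cong (x ∷_) raised
... | [] , true  | refl   = raiseLast-above-1̄ x≥y
... | [] , false | ()

lower-total : ∀ x xs → All Positive (x ∷ xs) → suc (total (proj₁ (lower x xs))) ≡ total (x ∷ xs)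
lower-total (zero , _)              [] (() ∷ _)
lower-total (suc zero , true)       [] _ = refl
lower-total (suc zero , false)      [] _ = refl
lower-total (suc (suc zero) , _)    [] _ = refl
lower-total (suc (suc (suc v)) , _) [] _ = refl
lower-total (u , _) (y ∷ ys) (_ ∷ pos) =
  trans (sym (+-suc u _)) (cong (u +_) (lower-total y ys pos))

lower-All : ∀ {P : Part → Set} → (∀ {x} → P x → All P (proj₁ (lowerLast x))) →
            ∀ x xs → All P (x ∷ xs) → All P (proj₁ (lower x xs))
lower-All lowerLast-P x []       (px ∷ [])  = lowerLast-P px
lower-All lowerLast-P x (y ∷ ys) (px ∷ pxs) = px ∷ lower-All lowerLast-P y ys pxs

lowerLast-admissible : ∀ {x} → (Positive ∩ NotPlainOne) x → All (Positive ∩ NotPlainOne) (proj₁ (lowerLast x))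
lowerLast-admissible {zero , _}              (() , _)
lowerLast-admissible {suc zero , true}       _ = []
lowerLast-admissible {suc zero , false}      (_ , big (s≤s ()))
lowerLast-admissible {suc (suc zero) , _}    _ = (s≤s z≤n , overlined) ∷ []
lowerLast-admissible {suc (suc (suc v)) , c} (_ , np) = (s≤s z≤n , lowered np) ∷ []
  where
  lowered : NotPlainOne (suc (suc (suc v)) , c) → NotPlainOne (suc (suc v) , c)
  lowered overlined = overlined
  lowered (big _)   = big (s≤s (s≤s z≤n))

lower-head : ∀ {w} x xs → Positive x → Step w x → Connected Step (just w) (head (proj₁ (lower x xs)))
lower-head (zero , _)              [] ()
lower-head (suc zero , true)       [] _ _   = just-nothing
lower-head (suc zero , false)      [] _ w≥x = just (Step-pred w≥x)
lower-head (suc (suc zero) , _)    [] _ w≥x = just (Step-pred w≥x)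
lower-head (suc (suc (suc v)) , _) [] _ w≥x = just (Step-pred w≥x)
lower-head x (y ∷ ys) _ w≥x = just w≥x

lower-linked : ∀ x xs → All Positive (x ∷ xs) → Linked Step (x ∷ xs) → Linked Step (proj₁ (lower x xs))
lower-linked (zero , _)              [] (() ∷ _) _
lower-linked (suc zero , true)       [] _ _ = []
lower-linked (suc zero , false)      [] _ _ = [-]
lower-linked (suc (suc zero) , _)    [] _ _ = [-]
lower-linked (suc (suc (suc v)) , _) [] _ _ = [-]
lower-linked x (y ∷ ys) (_ ∷ pos) (x≥y ∷ ord) =
  lower-head y ys (All.head pos) x≥y ∷′ lower-linked y ys pos ord

overpartition-of-1 : Bool → Overpartition 1
overpartition-of-1 b = mkOP ((1 , b) ∷ []) (s≤s z≤n ∷ []) [-] refl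

overline-of-1 : Overpartition 1 → Bool
overline-of-1 (mkOP ((_ , b) ∷ _) _ _ _) = b
overline-of-1 (mkOP [] _ _ ())

lowerOverpartition : ∀ {a} → OverpartitionNo1 (suc a) → OverpartitionNo1 a × Overpartition 1
lowerOverpartition (mkOPno1 (mkOP [] _ _ ()) _)
lowerOverpartition (mkOPno1 (mkOP (x ∷ xs) pos ord sums) no1) =
  mkOPno1 (mkOP (proj₁ (lower x xs)) (proj₁ admissible) (lower-linked x xs pos ord)
                (suc-injective (trans (lower-total x xs pos) sums)))
          (proj₂ admissible)
  , overpartition-of-1 (proj₂ (lower x xs))
  where
  admissible : All Positive (proj₁ (lower x xs)) × All NotPlainOne (proj₁ (lower x xs))
  admissible = All.unzip (lower-All lowerLast-admissible x xs (All.zip (pos , no1)))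

raiseOverpartition : ∀ {a} → OverpartitionNo1 a × Overpartition 1 → List Part
raiseOverpartition (λ₁ , μ) = raise (parts λ₁) (overline-of-1 μ)

raise-lowerOverpartition : ∀ {a} (λ₁ : OverpartitionNo1 (suc a)) →
                           raiseOverpartition (lowerOverpartition λ₁) ≡ parts λ₁
raise-lowerOverpartition (mkOPno1 (mkOP [] _ _ ()) _)
raise-lowerOverpartition (mkOPno1 (mkOP (x ∷ xs) pos ord _) no1) = raise-lower x xs pos no1 ord

lowerOverpartition-injective : ∀ {a} → Injective _≡_ _≡_ (lowerOverpartition {a})
lowerOverpartition-injective {x = λ₁} {λ₂} eq = parts-injective λ₁ λ₂ (begin
  parts λ₁                                    ≡⟨ raise-lowerOverpartition λ₁ ⟨
  raiseOverpartition (lowerOverpartition λ₁)  ≡⟨ cong raiseOverpartition eq ⟩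
  raiseOverpartition (lowerOverpartition λ₂)  ≡⟨ raise-lowerOverpartition λ₂ ⟩
  parts λ₂                                    ∎)
  where open ≡-Reasoning

lowered-raisable : ∀ {a} (λ₁ : OverpartitionNo1 (suc a)) →
                   Linked Step (raiseOverpartition (lowerOverpartition λ₁))
lowered-raisable λ₁ = subst (Linked Step) (sym (raise-lowerOverpartition λ₁))
                            (Overpartition.ordered (OverpartitionNo1.op λ₁))

lowering : ∀ {a} → OverpartitionNo1 (suc a) ↣ (OverpartitionNo1 a × Overpartition 1)
lowering = mk↣ lowerOverpartition-injective

plain-above-2̄ : ∀ k → Step (suc (suc k) , false) (2 , true)
plain-above-2̄ zero    = equal
plain-above-2̄ (suc k) = strict (s≤s (s≤s (s≤s z≤n)))

unraisable : ∀ a → 3 ≤ a → Σ[ w ∈ OverpartitionNo1 a × Overpartition 1 ] ¬ Linked Step (raiseOverpartition w)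
unraisable 1 (s≤s ())
unraisable 2 (s≤s (s≤s ()))
unraisable 3 _ =
  (mkOPno1 (mkOP ((2 , true) ∷ (1 , true) ∷ []) (s≤s z≤n ∷ s≤s z≤n ∷ []) (strict ≤-refl ∷ [-]) refl)
           (overlined ∷ overlined ∷ [])
  , overpartition-of-1 true)
  , λ { (strict (s≤s (s≤s ())) ∷ _) }
unraisable 4 _ =
  (mkOPno1 (mkOP ((2 , false) ∷ (2 , true) ∷ []) (s≤s z≤n ∷ s≤s z≤n ∷ []) (equal ∷ [-]) refl)
           (big ≤-refl ∷ overlined ∷ [])
  , overpartition-of-1 false)
  , λ { (strict (s≤s (s≤s ())) ∷ _) }
unraisable (suc (suc (suc (suc (suc k))))) _ =
  (mkOPno1 (mkOP ((suc (suc k) , false) ∷ (2 , true) ∷ (1 , true) ∷ [])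
                 (s≤s z≤n ∷ s≤s z≤n ∷ s≤s z≤n ∷ [])
                 (plain-above-2̄ k ∷ strict ≤-refl ∷ [-])
                 (cong (λ n → suc (suc n)) (+-comm k 3)))
           (big (s≤s (s≤s z≤n)) ∷ overlined ∷ overlined ∷ [])
  , overpartition-of-1 true)
  , λ { (_ ∷ strict (s≤s (s≤s ())) ∷ _) }

lemma2p2 : (a : ℕ) → 1 ≤ a → (x y z : ℕ)
    → OverpartitionNo1 a HasSize x
    → Overpartition 1 HasSize y
    → OverpartitionNo1 (suc a) HasSize z
    → (z ≤ x * y) × (3 ≤ a → z < x * y)
lemma2p2 a _ x y z no1-a one no1-suc-a =
  HasSize-≤ no1-suc-a pairs lowering , strict-for-3≤a
  where
  pairs : (OverpartitionNo1 a × Overpartition 1) HasSize (x * y)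
  pairs = ×-HasSize no1-a one

  strict-for-3≤a : 3 ≤ a → z < x * y
  strict-for-3≤a 3≤a with w , w-unraisable ← unraisable a 3≤a =
    HasSize-< no1-suc-a pairs lowering w λ λ₁ lowered≡w →
      w-unraisable (subst (Linked Step ∘ raiseOverpartition) lowered≡w (lowered-raisable λ₁))
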